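{- For every integer $n\ge 1$ and every $k\ge 1$, the number of $e\in\mathbf{I}_n(021)$ with exactly $k$ maximal elements equals the number of Schröder $(n-1)$-paths whose maximal initial run of up steps has length exactly $k-1$.
   Context: An inversion sequence of length $n$ is an integer sequence $e=(e_1,\ldots,e_n)$ with $0 \le e_i < i$ for all $i$; $\mathbf{I}_n$ is the set of these. $\mathbf{I}_n(021)$ is the set of $e\in\mathbf{I}_n$ with no indices $i<j<k$ such that $e_i<e_k<e_j$. An entry $e_i$ is maximal if $e_i=i-1$ (so $e_1=0$ is always maximal). A Schröder $m$-path is a lattice path from $(0,0)$ to $(2m,0)$ never going below the $x$-axis, with steps $U=(1,1)$, $D=(1,-1)$, $F=(2,0)$; its number of initial up steps is the number of $U$ steps before the first non-$U$ step (or the end of the path). -}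

module Defs where

open import Data.Nat using (ℕ; zero; suc; _+_; _∸_; _<ᵇ_; _≡ᵇ_)
open import Data.Bool using (Bool; true; false; _∧_; _∨_; not; if_then_else_)
open import Data.List using (List; []; _∷_; _++_; [_]; map; concatMap; length; filter; upTo; takeWhile)
open import Data.Bool.ListAction using (any)
open import Relation.Nullary.Decidable using (Dec)
open import Data.Bool.Properties using (T?)

-- Inversion sequences.  A sequence e = (e_1,…,e_n) is a list of length n;
-- the list element at 0-based position p is e_{p+1}.

-- 0-based lookup with default 0 (only used at in-range positions)
at : List ℕ → ℕ → ℕ
at []       _       = 0
at (x ∷ _)  zero    = x
at (_ ∷ xs) (suc p) = at xs p

I : ℕ → List (List ℕ)
I zero    = [] ∷ []
I (suc n) = concatMap (λ e → map (λ x → e ++ [ x ]) (upTo (suc n))) (I n)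

contains021 : List ℕ → Bool
contains021 e =
  any (λ k → any (λ j → any (λ i →
        (i <ᵇ j) ∧ (j <ᵇ k) ∧ (at e i <ᵇ at e k) ∧ (at e k <ᵇ at e j))
      (upTo (length e))) (upTo (length e))) (upTo (length e))

avoids021 : List ℕ → Bool
avoids021 e = not (contains021 e)

I021 : ℕ → List (List ℕ)
I021 n = filter (λ e → T? (avoids021 e)) (I n)

-- number of maximal entries: 1-based positions i with e_i = i - 1,
-- i.e. 0-based positions p with (element at p) = p
maxCount : List ℕ → ℕ
maxCount e = length (filter (λ p → T? (at e p ≡ᵇ p)) (upTo (length e)))

data Step : Set where
  U D F : Step

-- all step words whose total x-length is exactly len (U,D have length 1, F length 2)
words : ℕ → List (List Step)
words zero          = [] ∷ []
words (suc zero)    = (U ∷ []) ∷ (D ∷ []) ∷ []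
words (suc (suc l)) =
  map (U ∷_) (words (suc l)) ++ map (D ∷_) (words (suc l)) ++ map (F ∷_) (words l)

valid : ℕ → List Step → Bool
valid zero    []      = true
valid (suc _) []      = false
valid h       (U ∷ w) = valid (suc h) w
valid zero    (D ∷ w) = false
valid (suc h) (D ∷ w) = valid h w
valid h       (F ∷ w) = valid h w

schroder : ℕ → List (List Step)
schroder m = filter (λ w → T? (valid 0 w)) (words (m + m))

isU : Step → Bool
isU U = true
isU D = false
isU F = false

initialUps : List Step → ℕ
initialUps w = length (takeWhile (λ s → T? (isU s)) w)

module Submission where

-- Both counts, for n = r + 1 and k = j + 1, are shown to equal
-- the coefficient [x^r] of Ψ 0 j = x^j S^j (1 + xS), where S = 1 + xS + xS² is
-- the large Schröder series and L = 1 + xLS (so that 2L = 1 + S).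
--  * Schröder side: a path with exactly j initial up steps is U^j followed by a
--    path from height j starting with D or F; the paths of length h + 2t from
--    height h are counted by [x^t] S^(h+1), as both obey the first-step recurrence.
--  * Inversion side: appending x to a 021-avoiding sequence (which starts with 0)
--    keeps it avoiding iff x = 0 or x ≥ threshold (the maximum, taken ≥ 1).  So the
--    number of completions of a prefix depends only on the gap g = length − threshold
--    and on the number k of maximal entries still to come, and it satisfies the
--    recurrence of the coefficients of Ψ g k = x^k S^k V g (Ψ-rec).

open import Defs
open import Data.Nat using (ℕ; zero; suc; _+_; _*_; _∸_; _≤_; _<_; _⊔_; z≤n; s≤s; z<s; s<s; _≡ᵇ_; _≤ᵇ_; _<ᵇ_; _≤?_)
open import Data.Nat.Properties
open import Data.Nat.ListAction using (sum)
open import Data.Nat.ListAction.Properties using (sum-++)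
open import Data.Nat.Tactic.RingSolver using (solve-∀)
open import Data.Bool using (Bool; true; false; T; _∧_; _∨_; not; if_then_else_)
open import Data.Bool.Properties using (T?; T-≡; T-∧; T-∨; ∧-zeroʳ)
open import Data.Bool.ListAction using (any)
open import Data.List using (List; []; _∷_; _++_; [_]; map; concatMap; length; filter; upTo; applyUpTo)
open import Data.List.Properties using (map-∘; map-cong; map-++; map-upTo; length-++; concatMap-++; concatMap-pure)
open import Data.List.Relation.Unary.Any.Properties using (any⁺; any⁻)
open import Data.List.Membership.Propositional using (find; lose)
open import Data.List.Membership.Propositional.Properties using (∈-upTo⁺; ∈-upTo⁻)
open import Data.Product using (∃; _×_; _,_)
open import Data.Sum using (_⊎_; inj₁; inj₂)
open import Data.Unit using (tt)
open import Data.Empty using (⊥-elim)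
open import Function using (_∘_)
open import Function.Bundles using (Equivalence)
open import Relation.Nullary using (¬_; does; yes; no)
open import Relation.Unary using (Decidable)
open import Relation.Binary.PropositionalEquality hiding ([_])
open import Algebra.Bundles using (CommutativeSemiring)
open import Algebra.Structures using (IsCommutativeSemiring)
import Algebra.Properties.CommutativeSemigroup as CommSemigroupProperties

open Equivalence using (to; from)

module Booleans where

  true-if : ∀ {b} → T b → b ≡ true
  true-if = to T-≡

  false-unless : ∀ {b} → ¬ T b → b ≡ false
  false-unless {true}  ¬t = ⊥-elim (¬t tt)
  false-unless {false} _  = refl

  bool-ext : ∀ {a b} → (T a → T b) → (T b → T a) → a ≡ b
  bool-ext {true}  {true}  _ _ = refl
  bool-ext {true}  {false} f _ = ⊥-elim (f tt)
  bool-ext {false} {true}  _ g = ⊥-elim (g tt)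
  bool-ext {false} {false} _ _ = refl

  ≡ᵇ-refl : ∀ m → (m ≡ᵇ m) ≡ true
  ≡ᵇ-refl m = true-if (≡⇒≡ᵇ m m refl)

  ≡ᵇ-≢ : ∀ {m n} → m ≢ n → (m ≡ᵇ n) ≡ false
  ≡ᵇ-≢ {m} {n} m≢n = false-unless (λ t → m≢n (≡ᵇ⇒≡ m n t))

  not-∨-not : ∀ a b → not (a ∨ not b) ≡ not a ∧ b
  not-∨-not true  b     = refl
  not-∨-not false true  = refl
  not-∨-not false false = refl

  if-cong : ∀ {b b' : Bool} {u u' : ℕ} → b ≡ b' → u ≡ u' → (if b then u else 0) ≡ (if b' then u' else 0)
  if-cong refl refl = refl

module Counting where

  ind : Bool → ℕ
  ind false = 0
  ind true  = 1

  count : {A : Set} → (A → Bool) → List A → ℕ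
  count p xs = sum (map (λ x → ind (p x)) xs)

  length-filter : ∀ {A : Set} {P : A → Set} (P? : Decidable P) xs →
    length (filter P? xs) ≡ count (λ x → does (P? x)) xs
  length-filter P? []       = refl
  length-filter P? (x ∷ xs) with does (P? x)
  ... | true  = cong suc (length-filter P? xs)
  ... | false = length-filter P? xs

  length-filter² : ∀ {A : Set} {P Q : A → Set} (P? : Decidable P) (Q? : Decidable Q) xs →
    length (filter Q? (filter P? xs)) ≡ count (λ x → does (P? x) ∧ does (Q? x)) xs
  length-filter² P? Q? []       = refl
  length-filter² P? Q? (x ∷ xs) with does (P? x)
  ... | false = length-filter² P? Q? xs
  ... | true with does (Q? x)
  ...   | true  = cong suc (length-filter² P? Q? xs)
  ...   | false = length-filter² P? Q? xs

  count-cong : ∀ {A : Set} {p q : A → Bool} xs → (∀ x → p x ≡ q x) → count p xs ≡ count q xs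
  count-cong xs p≗q = cong sum (map-cong (λ x → cong ind (p≗q x)) xs)

  count-++ : ∀ {A : Set} (p : A → Bool) xs ys → count p (xs ++ ys) ≡ count p xs + count p ys
  count-++ p xs ys = trans (cong sum (map-++ _ xs ys)) (sum-++ (map _ xs) (map _ ys))

  count-map : ∀ {A B : Set} (p : B → Bool) (f : A → B) xs → count p (map f xs) ≡ count (p ∘ f) xs
  count-map p f xs = cong sum (sym (map-∘ xs))

  count-concatMap : ∀ {A B : Set} (p : B → Bool) (f : A → List B) xs →
    count p (concatMap f xs) ≡ sum (map (λ x → count p (f x)) xs)
  count-concatMap p f []       = refl
  count-concatMap p f (x ∷ xs) =
    trans (count-++ p (f x) (concatMap f xs)) (cong (count p (f x) +_) (count-concatMap p f xs))

  count-none : ∀ {A : Set} (xs : List A) → count (λ _ → false) xs ≡ 0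
  count-none []       = refl
  count-none (x ∷ xs) = count-none xs

  Σ< : ℕ → (ℕ → ℕ) → ℕ
  Σ< n f = sum (applyUpTo f n)

  sum-upTo : ∀ (f : ℕ → ℕ) n → sum (map f (upTo n)) ≡ Σ< n f
  sum-upTo f n = cong sum (map-upTo f n)

  Σ<-cong : ∀ n {f g : ℕ → ℕ} → (∀ i → i < n → f i ≡ g i) → Σ< n f ≡ Σ< n g
  Σ<-cong zero    eq = refl
  Σ<-cong (suc n) eq = cong₂ _+_ (eq 0 z<s) (Σ<-cong n (λ i i<n → eq (suc i) (s<s i<n)))

  Σ<-zero : ∀ n {f : ℕ → ℕ} → (∀ i → i < n → f i ≡ 0) → Σ< n f ≡ 0
  Σ<-zero zero    eq = refl
  Σ<-zero (suc n) eq = cong₂ _+_ (eq 0 z<s) (Σ<-zero n (λ i i<n → eq (suc i) (s<s i<n)))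

  Σ<-+ : ∀ a b (f : ℕ → ℕ) → Σ< (a + b) f ≡ Σ< a f + Σ< b (λ i → f (a + i))
  Σ<-+ zero    b f = refl
  Σ<-+ (suc a) b f = trans (cong (f 0 +_) (Σ<-+ a b (f ∘ suc))) (sym (+-assoc (f 0) _ _))

  Σ<-last : ∀ n (f : ℕ → ℕ) → Σ< (suc n) f ≡ Σ< n f + f n
  Σ<-last n f = begin
    Σ< (suc n) f                        ≡⟨ cong (λ m → Σ< m f) (+-comm 1 n) ⟩
    Σ< (n + 1) f                        ≡⟨ Σ<-+ n 1 f ⟩
    Σ< n f + (f (n + 0) + 0)            ≡⟨ cong (Σ< n f +_) (trans (+-identityʳ _) (cong f (+-identityʳ n))) ⟩
    Σ< n f + f n                        ∎
    where open ≡-Reasoning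

-- They form a commutative semiring (so the ring solver applies), and every
-- causal map has a unique fixpoint, which is how S and L are defined.
module PowerSeries where

  Series : Set
  Series = ℕ → ℕ

  infix  4 _≋_
  infixl 6 _⊕_
  infixl 7 _⊛_

  _≋_ : Series → Series → Set
  f ≋ g = ∀ n → f n ≡ g n

  ≋-refl : ∀ {f} → f ≋ f
  ≋-refl _ = refl

  ≋-sym : ∀ {f g} → f ≋ g → g ≋ f
  ≋-sym f≋g n = sym (f≋g n)

  ≋-trans : ∀ {f g h} → f ≋ g → g ≋ h → f ≋ h
  ≋-trans f≋g g≋h n = trans (f≋g n) (g≋h n)

  _⊕_ : Series → Series → Series
  (f ⊕ g) n = f n + g n

  𝟘 𝟙 : Series
  𝟘 _       = 0
  𝟙 zero    = 1
  𝟙 (suc _) = 0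

  tail : Series → Series
  tail f n = f (suc n)

  shift : Series → Series
  shift f zero    = 0
  shift f (suc n) = f n

  scale : ℕ → Series → Series
  scale a f n = a * f n

  _⊛_ : Series → Series → Series
  (f ⊛ g) zero    = f 0 * g 0
  (f ⊛ g) (suc n) = f 0 * g (suc n) + (tail f ⊛ g) n

  ⊕-cong : ∀ {f f' g g'} → f ≋ f' → g ≋ g' → f ⊕ g ≋ f' ⊕ g'
  ⊕-cong f≋f' g≋g' n = cong₂ _+_ (f≋f' n) (g≋g' n)

  ⊛-cong : ∀ {f f' g g'} → f ≋ f' → g ≋ g' → f ⊛ g ≋ f' ⊛ g'
  ⊛-cong f≋f' g≋g' zero    = cong₂ _*_ (f≋f' 0) (g≋g' 0)
  ⊛-cong f≋f' g≋g' (suc n) =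
    cong₂ _+_ (cong₂ _*_ (f≋f' 0) (g≋g' (suc n))) (⊛-cong (λ i → f≋f' (suc i)) g≋g' n)

  ⊕-congˡ : ∀ {g g'} f → g ≋ g' → f ⊕ g ≋ f ⊕ g'
  ⊕-congˡ f = ⊕-cong ≋-refl

  ⊕-congʳ : ∀ {f f'} g → f ≋ f' → f ⊕ g ≋ f' ⊕ g
  ⊕-congʳ g f≋f' = ⊕-cong f≋f' ≋-refl

  ⊛-congˡ : ∀ {g g'} f → g ≋ g' → f ⊛ g ≋ f ⊛ g'
  ⊛-congˡ f = ⊛-cong ≋-refl

  ⊛-congʳ : ∀ {f f'} g → f ≋ f' → f ⊛ g ≋ f' ⊛ g
  ⊛-congʳ g f≋f' = ⊛-cong f≋f' ≋-refl

  ⊛-last : ∀ f g n → (f ⊛ g) (suc n) ≡ (f ⊛ tail g) n + f (suc n) * g 0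
  ⊛-last f g zero    = refl
  ⊛-last f g (suc n) = begin
    f 0 * g (suc (suc n)) + (tail f ⊛ g) (suc n)
      ≡⟨ cong (f 0 * g (suc (suc n)) +_) (⊛-last (tail f) g n) ⟩
    f 0 * g (suc (suc n)) + ((tail f ⊛ tail g) n + f (suc (suc n)) * g 0)
      ≡⟨ sym (+-assoc (f 0 * g (suc (suc n))) _ _) ⟩
    f 0 * g (suc (suc n)) + (tail f ⊛ tail g) n + f (suc (suc n)) * g 0 ∎
    where open ≡-Reasoning

  ⊛-comm : ∀ f g → f ⊛ g ≋ g ⊛ f
  ⊛-comm f g zero    = *-comm (f 0) (g 0)
  ⊛-comm f g (suc n) = begin
    (f ⊛ g) (suc n)                     ≡⟨ ⊛-last f g n ⟩
    (f ⊛ tail g) n + f (suc n) * g 0    ≡⟨ cong₂ _+_ (⊛-comm f (tail g) n) (*-comm (f (suc n)) (g 0)) ⟩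
    (tail g ⊛ f) n + g 0 * f (suc n)    ≡⟨ +-comm ((tail g ⊛ f) n) _ ⟩
    (g ⊛ f) (suc n)                     ∎
    where open ≡-Reasoning

  ⊛-distribʳ : ∀ f f' g → (f ⊕ f') ⊛ g ≋ f ⊛ g ⊕ f' ⊛ g
  ⊛-distribʳ f f' g zero    = *-distribʳ-+ (g 0) (f 0) (f' 0)
  ⊛-distribʳ f f' g (suc n) = begin
    (f 0 + f' 0) * g (suc n) + ((tail f ⊕ tail f') ⊛ g) n
      ≡⟨ cong₂ _+_ (*-distribʳ-+ (g (suc n)) (f 0) (f' 0)) (⊛-distribʳ (tail f) (tail f') g n) ⟩
    (f 0 * g (suc n) + f' 0 * g (suc n)) + ((tail f ⊛ g) n + (tail f' ⊛ g) n)
      ≡⟨ CommSemigroupProperties.interchange +-commutativeSemigroup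
           (f 0 * g (suc n)) (f' 0 * g (suc n)) ((tail f ⊛ g) n) ((tail f' ⊛ g) n) ⟩
    (f 0 * g (suc n) + (tail f ⊛ g) n) + (f' 0 * g (suc n) + (tail f' ⊛ g) n) ∎
    where open ≡-Reasoning

  ⊛-zeroˡ : ∀ g → 𝟘 ⊛ g ≋ 𝟘
  ⊛-zeroˡ g zero    = refl
  ⊛-zeroˡ g (suc n) = ⊛-zeroˡ g n

  ⊛-identityˡ : ∀ g → 𝟙 ⊛ g ≋ g
  ⊛-identityˡ g zero    = +-identityʳ (g 0)
  ⊛-identityˡ g (suc n) =
    trans (cong (g (suc n) + 0 +_) (⊛-zeroˡ g n)) (trans (+-identityʳ _) (+-identityʳ _))

  ⊛-scaleˡ : ∀ a g h → scale a g ⊛ h ≋ scale a (g ⊛ h)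
  ⊛-scaleˡ a g h zero    = *-assoc a (g 0) (h 0)
  ⊛-scaleˡ a g h (suc n) =
    trans (cong₂ _+_ (*-assoc a (g 0) (h (suc n))) (⊛-scaleˡ a (tail g) h n))
          (sym (*-distribˡ-+ a (g 0 * h (suc n)) _))

  ⊛-split : ∀ f g → f ⊛ g ≋ scale (f 0) g ⊕ shift (tail f ⊛ g)
  ⊛-split f g zero    = sym (+-identityʳ _)
  ⊛-split f g (suc n) = refl

  ⊛-assoc : ∀ f g h → (f ⊛ g) ⊛ h ≋ f ⊛ (g ⊛ h)
  ⊛-assoc f g h zero    = *-assoc (f 0) (g 0) (h 0)
  ⊛-assoc f g h (suc n) = begin
    ((f ⊛ g) ⊛ h) (suc n)
      ≡⟨ ⊛-cong (⊛-split f g) ≋-refl (suc n) ⟩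
    ((scale (f 0) g ⊕ shift (tail f ⊛ g)) ⊛ h) (suc n)
      ≡⟨ ⊛-distribʳ (scale (f 0) g) (shift (tail f ⊛ g)) h (suc n) ⟩
    (scale (f 0) g ⊛ h) (suc n) + ((tail f ⊛ g) ⊛ h) n
      ≡⟨ cong₂ _+_ (⊛-scaleˡ (f 0) g h (suc n)) (⊛-assoc (tail f) g h n) ⟩
    (f ⊛ (g ⊛ h)) (suc n) ∎
    where open ≡-Reasoning

  series-isSemiring : IsCommutativeSemiring _≋_ _⊕_ _⊛_ 𝟘 𝟙
  series-isSemiring = record
    { isSemiring = record
      { isSemiringWithoutAnnihilatingZero = record
        { +-isCommutativeMonoid = record
          { isMonoid = record
            { isSemigroup = record
              { isMagma = record
                { isEquivalence = record { refl = ≋-refl ; sym = ≋-sym ; trans = ≋-trans }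
                ; ∙-cong = ⊕-cong }
              ; assoc = λ f g h n → +-assoc (f n) (g n) (h n) }
            ; identity = (λ f n → refl) , (λ f n → +-identityʳ (f n)) }
          ; comm = λ f g n → +-comm (f n) (g n) }
        ; *-cong = ⊛-cong
        ; *-assoc = ⊛-assoc
        ; *-identity = ⊛-identityˡ , (λ f n → trans (⊛-comm f 𝟙 n) (⊛-identityˡ f n))
        ; distrib = (λ f g g' n → trans (⊛-comm f (g ⊕ g') n)
                       (trans (⊛-distribʳ g g' f n) (cong₂ _+_ (⊛-comm g f n) (⊛-comm g' f n))))
                  , (λ g f f' → ⊛-distribʳ f f' g) }
      ; zero = ⊛-zeroˡ , (λ f n → trans (⊛-comm f 𝟘 n) (⊛-zeroˡ f n)) }
    ; *-comm = ⊛-comm }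

  series-semiring : CommutativeSemiring _ _
  series-semiring = record { isCommutativeSemiring = series-isSemiring }

  X : Series
  X = shift 𝟙

  X⊛-shift : ∀ f → X ⊛ f ≋ shift f
  X⊛-shift f zero    = refl
  X⊛-shift f (suc n) = ⊛-identityˡ f n

  pow : Series → ℕ → Series
  pow f zero    = 𝟙
  pow f (suc k) = f ⊛ pow f k

  X-pow-coeff : ∀ j A t → (pow X j ⊛ A) (j + t) ≡ A t
  X-pow-coeff zero    A t = ⊛-identityˡ A t
  X-pow-coeff (suc j) A t =
    trans (⊛-assoc X (pow X j) A (suc (j + t))) (trans (X⊛-shift _ (suc (j + t))) (X-pow-coeff j A t))

  X-pow-low : ∀ j A m → m < j → (pow X j ⊛ A) m ≡ 0
  X-pow-low zero    A m       ()
  X-pow-low (suc j) A zero    _         = ⊛-assoc X (pow X j) A 0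
  X-pow-low (suc j) A (suc m) (s<s m<j) =
    trans (⊛-assoc X (pow X j) A (suc m)) (trans (X⊛-shift _ (suc m)) (X-pow-low j A m m<j))

  Causal : (Series → Series) → Set
  Causal Φ = ∀ f g n → (∀ i → i < n → f i ≡ g i) → Φ f n ≡ Φ g n

  ⊛-causal : ∀ f g f' g' n → (∀ i → i ≤ n → f i ≡ g i) → (∀ i → i ≤ n → f' i ≡ g' i) →
    (f ⊛ f') n ≡ (g ⊛ g') n
  ⊛-causal f g f' g' zero    e e' = cong₂ _*_ (e 0 z≤n) (e' 0 z≤n)
  ⊛-causal f g f' g' (suc n) e e' =
    cong₂ _+_ (cong₂ _*_ (e 0 z≤n) (e' (suc n) ≤-refl))
      (⊛-causal (tail f) (tail g) f' g' n (λ i i≤n → e (suc i) (s≤s i≤n)) (λ i i≤n → e' i (m≤n⇒m≤1+n i≤n)))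

  module Fixpoint (Φ : Series → Series) (causal : Causal Φ) where

    approx : ℕ → Series
    approx zero    = 𝟘
    approx (suc m) = Φ (approx m)

    approx-stable : ∀ m d i → i < m → approx (m + d) i ≡ approx m i
    approx-stable (suc m) d i i<m =
      causal _ _ i (λ j j<i → approx-stable m d j (<-≤-trans j<i (≤-pred i<m)))

    fix : Series
    fix n = approx (suc n) n

    fix-eq : fix ≋ Φ fix
    fix-eq n = causal (approx n) fix n agree
      where
      agree : ∀ i → i < n → approx n i ≡ fix i
      agree i i<n = subst (λ m → approx m i ≡ fix i) (m+[n∸m]≡n i<n) (approx-stable (suc i) (n ∸ suc i) i ≤-refl)

  fix-unique : ∀ Φ → Causal Φ → ∀ {f g} → f ≋ Φ f → g ≋ Φ g → f ≋ g
  fix-unique Φ causal {f} {g} f≋Φf g≋Φg n = agree (suc n) n ≤-refl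
    where
    agree : ∀ m i → i < m → f i ≡ g i
    agree (suc m) i i<m =
      trans (f≋Φf i) (trans (causal f g i (λ j j<i → agree m j (<-≤-trans j<i (≤-pred i<m)))) (sym (g≋Φg i)))

module SchroderSeries where

  open PowerSeries
  open import Algebra.Solver.Ring.NaturalCoefficients.Default series-semiring
  open import Relation.Binary.Reasoning.Setoid (CommutativeSemiring.setoid series-semiring)

  S-step : Series → Series
  S-step f = 𝟙 ⊕ shift (f ⊕ f ⊛ f)

  S-step-causal : Causal S-step
  S-step-causal f g zero    _     = refl
  S-step-causal f g (suc n) agree = cong₂ _+_ (agree n (n<1+n n))
    (⊛-causal f g f g n (λ i i≤n → agree i (s≤s i≤n)) (λ i i≤n → agree i (s≤s i≤n)))

  S : Series
  S = Fixpoint.fix S-step S-step-causal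

  S-eq : S ≋ 𝟙 ⊕ X ⊛ S ⊕ X ⊛ S ⊛ S
  S-eq = begin
    S                       ≈⟨ Fixpoint.fix-eq S-step S-step-causal ⟩
    𝟙 ⊕ shift (S ⊕ S ⊛ S)   ≈⟨ ⊕-congˡ 𝟙 (≋-sym (X⊛-shift (S ⊕ S ⊛ S))) ⟩
    𝟙 ⊕ X ⊛ (S ⊕ S ⊛ S)     ≈⟨ solve 2 (λ x s → con 1 :+ x :* (s :+ s :* s) := con 1 :+ x :* s :+ x :* s :* s) ≋-refl X S ⟩
    𝟙 ⊕ X ⊛ S ⊕ X ⊛ S ⊛ S   ∎

  L-step : Series → Series
  L-step f = 𝟙 ⊕ shift (f ⊛ S)

  L-step-causal : Causal L-step
  L-step-causal f g zero    _     = refl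
  L-step-causal f g (suc n) agree = ⊛-causal f g S S n (λ i i≤n → agree i (s≤s i≤n)) (λ _ _ → refl)

  L : Series
  L = Fixpoint.fix L-step L-step-causal

  L-eq : L ≋ 𝟙 ⊕ X ⊛ L ⊛ S
  L-eq = begin
    L                  ≈⟨ Fixpoint.fix-eq L-step L-step-causal ⟩
    𝟙 ⊕ shift (L ⊛ S)  ≈⟨ ⊕-congˡ 𝟙 (≋-sym (X⊛-shift (L ⊛ S))) ⟩
    𝟙 ⊕ X ⊛ (L ⊛ S)    ≈⟨ solve 3 (λ x l s → con 1 :+ x :* (l :* s) := con 1 :+ x :* l :* s) ≋-refl X L S ⟩
    𝟙 ⊕ X ⊛ L ⊛ S      ∎

  -- 2L = 1 + S: both are the fixpoint of f ↦ 2 + x f S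
  L-double : L ⊕ L ≋ 𝟙 ⊕ S
  L-double = fix-unique double-step double-step-causal 2L-fixed 1+S-fixed
    where
    double-step : Series → Series
    double-step f = (𝟙 ⊕ 𝟙) ⊕ shift (f ⊛ S)

    double-step-causal : Causal double-step
    double-step-causal f g zero    _     = refl
    double-step-causal f g (suc n) agree = ⊛-causal f g S S n (λ i i≤n → agree i (s≤s i≤n)) (λ _ _ → refl)

    2L-fixed : L ⊕ L ≋ double-step (L ⊕ L)
    2L-fixed = begin
      L ⊕ L                                 ≈⟨ ⊕-cong L-eq L-eq ⟩
      (𝟙 ⊕ X ⊛ L ⊛ S) ⊕ (𝟙 ⊕ X ⊛ L ⊛ S)
        ≈⟨ solve 3 (λ x l s → (con 1 :+ x :* l :* s) :+ (con 1 :+ x :* l :* s) := (con 1 :+ con 1) :+ x :* ((l :+ l) :* s)) ≋-refl X L S ⟩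
      (𝟙 ⊕ 𝟙) ⊕ X ⊛ ((L ⊕ L) ⊛ S)           ≈⟨ ⊕-congˡ (𝟙 ⊕ 𝟙) (X⊛-shift ((L ⊕ L) ⊛ S)) ⟩
      double-step (L ⊕ L)                   ∎

    1+S-fixed : 𝟙 ⊕ S ≋ double-step (𝟙 ⊕ S)
    1+S-fixed = begin
      𝟙 ⊕ S                                 ≈⟨ ⊕-congˡ 𝟙 S-eq ⟩
      𝟙 ⊕ (𝟙 ⊕ X ⊛ S ⊕ X ⊛ S ⊛ S)
        ≈⟨ solve 2 (λ x s → con 1 :+ (con 1 :+ x :* s :+ x :* s :* s) := (con 1 :+ con 1) :+ x :* ((con 1 :+ s) :* s)) ≋-refl X S ⟩
      (𝟙 ⊕ 𝟙) ⊕ X ⊛ ((𝟙 ⊕ S) ⊛ S)           ≈⟨ ⊕-congˡ (𝟙 ⊕ 𝟙) (X⊛-shift ((𝟙 ⊕ S) ⊛ S)) ⟩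
      double-step (𝟙 ⊕ S)                   ∎

  pow-S-zero : ∀ k → pow S k 0 ≡ 1
  pow-S-zero zero    = refl
  pow-S-zero (suc k) = cong (S 0 *_) (pow-S-zero k)

  -- S^(h+1) = S^h + x S^(h+1) + x S^(h+2): the first-step recurrence of paths
  pow-S-rec : ∀ h → pow S (suc h) ≋ pow S h ⊕ X ⊛ pow S (suc h) ⊕ X ⊛ pow S (suc (suc h))
  pow-S-rec h = begin
    S ⊛ P                                ≈⟨ ⊛-congʳ P S-eq ⟩
    (𝟙 ⊕ X ⊛ S ⊕ X ⊛ S ⊛ S) ⊛ P
      ≈⟨ solve 3 (λ x s p → (con 1 :+ x :* s :+ x :* s :* s) :* p := p :+ x :* (s :* p) :+ x :* (s :* (s :* p))) ≋-refl X S P ⟩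
    P ⊕ X ⊛ (S ⊛ P) ⊕ X ⊛ (S ⊛ (S ⊛ P))  ∎
    where P = pow S h

  pow-S-V0 : ∀ j → pow S j ⊛ (𝟙 ⊕ X ⊛ S) ≋ pow S j ⊕ X ⊛ pow S (suc j)
  pow-S-V0 j = solve 3 (λ p x s → p :* (con 1 :+ x :* s) := p :+ x :* (s :* p)) ≋-refl (pow S j) X S

  -- V g belongs to a completion state with gap g: V 0 = 1 + xS, V (h+1) = S L^h
  V : ℕ → Series
  V zero    = 𝟙 ⊕ X ⊛ S
  V (suc h) = S ⊛ pow L h

  RV : ℕ → Series
  RV zero    = 𝟘
  RV (suc g) = V (suc (suc g)) ⊕ RV g

  -- the recurrence behind the completion counts, from L = 1 + xLS and 2L = 1 + S
  V-rec : ∀ g → V g ≋ 𝟙 ⊕ X ⊛ (V (suc g) ⊕ RV g)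
  V-rec zero = solve 2 (λ x s → con 1 :+ x :* s := con 1 :+ x :* (s :* con 1 :+ con 0)) ≋-refl X S
  V-rec (suc zero) = begin
    S ⊛ 𝟙                               ≈⟨ solve 1 (λ s → s :* con 1 := s) ≋-refl S ⟩
    S                                   ≈⟨ S-eq ⟩
    𝟙 ⊕ X ⊛ S ⊕ X ⊛ S ⊛ S               ≈⟨ solve 2 (λ x s → con 1 :+ x :* s :+ x :* s :* s := con 1 :+ x :* s :* (con 1 :+ s)) ≋-refl X S ⟩
    𝟙 ⊕ X ⊛ S ⊛ (𝟙 ⊕ S)                 ≈⟨ ⊕-congˡ 𝟙 (⊛-congˡ (X ⊛ S) (≋-sym L-double)) ⟩
    𝟙 ⊕ X ⊛ S ⊛ (L ⊕ L)
      ≈⟨ solve 3 (λ x s l → con 1 :+ x :* s :* (l :+ l) := con 1 :+ x :* (s :* (l :* con 1) :+ (s :* (l :* con 1) :+ con 0))) ≋-refl X S L ⟩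
    𝟙 ⊕ X ⊛ (V 2 ⊕ RV 1)                ∎
  V-rec (suc (suc h)) = begin
    S ⊛ (L ⊛ P)                         ≈⟨ ⊛-congˡ S (⊛-congʳ P L-eq) ⟩
    S ⊛ ((𝟙 ⊕ X ⊛ L ⊛ S) ⊛ P)
      ≈⟨ solve 4 (λ s x l p → s :* ((con 1 :+ x :* l :* s) :* p) := s :* p :+ x :* s :* s :* l :* p) ≋-refl S X L P ⟩
    S ⊛ P ⊕ X ⊛ S ⊛ S ⊛ L ⊛ P           ≈⟨ ⊕-congʳ (X ⊛ S ⊛ S ⊛ L ⊛ P) (V-rec (suc h)) ⟩
    (𝟙 ⊕ X ⊛ (S ⊛ (L ⊛ P) ⊕ (S ⊛ (L ⊛ P) ⊕ Q))) ⊕ X ⊛ S ⊛ S ⊛ L ⊛ P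
      ≈⟨ solve 5 (λ s x l p q → (con 1 :+ x :* (s :* (l :* p) :+ (s :* (l :* p) :+ q))) :+ x :* s :* s :* l :* p
                                := con 1 :+ x :* (s :* (l :* p) :+ q) :+ x :* s :* l :* p :* (con 1 :+ s)) ≋-refl S X L P Q ⟩
    𝟙 ⊕ X ⊛ (S ⊛ (L ⊛ P) ⊕ Q) ⊕ X ⊛ S ⊛ L ⊛ P ⊛ (𝟙 ⊕ S)
      ≈⟨ ⊕-congˡ (𝟙 ⊕ X ⊛ (S ⊛ (L ⊛ P) ⊕ Q)) (⊛-congˡ (X ⊛ S ⊛ L ⊛ P) (≋-sym L-double)) ⟩
    𝟙 ⊕ X ⊛ (S ⊛ (L ⊛ P) ⊕ Q) ⊕ X ⊛ S ⊛ L ⊛ P ⊛ (L ⊕ L)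
      ≈⟨ solve 5 (λ s x l p q → con 1 :+ x :* (s :* (l :* p) :+ q) :+ x :* s :* l :* p :* (l :+ l)
                                := con 1 :+ x :* (s :* (l :* (l :* p)) :+ (s :* (l :* (l :* p)) :+ (s :* (l :* p) :+ q)))) ≋-refl S X L P Q ⟩
    𝟙 ⊕ X ⊛ (V (3 + h) ⊕ RV (2 + h))    ∎
    where
    P = pow L h
    Q = RV h

  -- Ψ g k: completions from gap g that create exactly k more maximal entries
  Ψ : ℕ → ℕ → Series
  Ψ g k = pow X k ⊛ (pow S k ⊛ V g)

  ΣΨ : ℕ → ℕ → Series
  ΣΨ zero    k = 𝟘
  ΣΨ (suc g) k = Ψ (suc (suc g)) k ⊕ ΣΨ g k

  ΣΨ-closed : ∀ g k → ΣΨ g k ≋ pow X k ⊛ (pow S k ⊛ RV g)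
  ΣΨ-closed zero    k = solve 2 (λ px ps → con 0 := px :* (ps :* con 0)) ≋-refl (pow X k) (pow S k)
  ΣΨ-closed (suc g) k = begin
    Ψ (suc (suc g)) k ⊕ ΣΨ g k                              ≈⟨ ⊕-congˡ (Ψ (suc (suc g)) k) (ΣΨ-closed g k) ⟩
    pow X k ⊛ (pow S k ⊛ V (suc (suc g))) ⊕ pow X k ⊛ (pow S k ⊛ RV g)
      ≈⟨ solve 4 (λ px ps v r → px :* (ps :* v) :+ px :* (ps :* r) := px :* (ps :* (v :+ r))) ≋-refl (pow X k) (pow S k) (V (suc (suc g))) (RV g) ⟩
    pow X k ⊛ (pow S k ⊛ RV (suc g))                        ∎

  -- the constant term and the contribution of a new maximal entry
  C : ℕ → Series
  C zero    = 𝟙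
  C (suc _) = 𝟘

  E : ℕ → Series
  E zero    = 𝟘
  E (suc k) = Ψ 1 k

  lift : ∀ k {A B} → A ≋ 𝟙 ⊕ X ⊛ B → pow X k ⊛ (pow S k ⊛ A) ≋ C k ⊕ X ⊛ (pow X k ⊛ (pow S k ⊛ B) ⊕ E k)
  lift zero {A} {B} A≋ = begin
    𝟙 ⊛ (𝟙 ⊛ A)                  ≈⟨ solve 1 (λ a → con 1 :* (con 1 :* a) := a) ≋-refl A ⟩
    A                            ≈⟨ A≋ ⟩
    𝟙 ⊕ X ⊛ B                    ≈⟨ solve 2 (λ x b → con 1 :+ x :* b := con 1 :+ x :* (con 1 :* (con 1 :* b) :+ con 0)) ≋-refl X B ⟩
    𝟙 ⊕ X ⊛ (𝟙 ⊛ (𝟙 ⊛ B) ⊕ 𝟘)    ∎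
  lift (suc k) {A} {B} A≋ = begin
    X ⊛ Px ⊛ (S ⊛ Ps ⊛ A)        ≈⟨ ⊛-congˡ (X ⊛ Px) (⊛-congˡ (S ⊛ Ps) A≋) ⟩
    X ⊛ Px ⊛ (S ⊛ Ps ⊛ (𝟙 ⊕ X ⊛ B))
      ≈⟨ solve 5 (λ x px s ps b → x :* px :* (s :* ps :* (con 1 :+ x :* b))
                                  := con 0 :+ x :* (x :* px :* (s :* ps :* b) :+ px :* (ps :* (s :* con 1)))) ≋-refl X Px S Ps B ⟩
    𝟘 ⊕ X ⊛ (X ⊛ Px ⊛ (S ⊛ Ps ⊛ B) ⊕ Px ⊛ (Ps ⊛ (S ⊛ 𝟙))) ∎
    where
    Px = pow X k
    Ps = pow S k

  -- the completion recurrence: appending 0 (gap g + 1), an entry making gap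
  -- 2, …, g + 1 (ΣΨ), or a new maximal entry (E)
  Ψ-rec : ∀ g k → Ψ g k ≋ C k ⊕ X ⊛ (Ψ (suc g) k ⊕ ΣΨ g k ⊕ E k)
  Ψ-rec g k = begin
    Ψ g k                                                 ≈⟨ lift k (V-rec g) ⟩
    C k ⊕ X ⊛ (pow X k ⊛ (pow S k ⊛ (V (suc g) ⊕ RV g)) ⊕ E k)
      ≈⟨ ⊕-congˡ (C k) (⊛-congˡ X (⊕-congʳ (E k) split)) ⟩
    C k ⊕ X ⊛ (Ψ (suc g) k ⊕ ΣΨ g k ⊕ E k)               ∎
    where
    split : pow X k ⊛ (pow S k ⊛ (V (suc g) ⊕ RV g)) ≋ Ψ (suc g) k ⊕ ΣΨ g k
    split = begin
      pow X k ⊛ (pow S k ⊛ (V (suc g) ⊕ RV g))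
        ≈⟨ solve 4 (λ px ps v r → px :* (ps :* (v :+ r)) := px :* (ps :* v) :+ px :* (ps :* r)) ≋-refl (pow X k) (pow S k) (V (suc g)) (RV g) ⟩
      Ψ (suc g) k ⊕ pow X k ⊛ (pow S k ⊛ RV g)            ≈⟨ ⊕-congˡ (Ψ (suc g) k) (≋-sym (ΣΨ-closed g k)) ⟩
      Ψ (suc g) k ⊕ ΣΨ g k                                ∎

  Ψ-zero : ∀ g k → Ψ g k 0 ≡ C k 0
  Ψ-zero g k = trans (Ψ-rec g k 0) (+-identityʳ (C k 0))

  Ψ-suc : ∀ g k r → Ψ g k (suc r) ≡ Ψ (suc g) k r + ΣΨ g k r + E k r
  Ψ-suc g k r = trans (Ψ-rec g k (suc r)) (cong₂ _+_ (C-vanishes k) (X⊛-shift _ (suc r)))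
    where
    C-vanishes : ∀ k → C k (suc r) ≡ 0
    C-vanishes zero    = refl
    C-vanishes (suc _) = refl

module SchroderPaths where

  open Counting
  open PowerSeries
  open SchroderSeries

  paths : ℕ → ℕ → (List Step → Bool) → ℕ
  paths L h q = count (λ w → valid h w ∧ q w) (words L)

  down-paths : ℕ → ℕ → (List Step → Bool) → ℕ
  down-paths L zero    q = 0
  down-paths L (suc h) q = paths L h q

  valid-U : ∀ h w → valid h (U ∷ w) ≡ valid (suc h) w
  valid-U zero    w = refl
  valid-U (suc h) w = refl

  valid-F : ∀ h w → valid h (F ∷ w) ≡ valid h w
  valid-F zero    w = refl
  valid-F (suc h) w = refl

  first-step : ∀ L h q → paths (suc (suc L)) h q
    ≡ paths (suc L) (suc h) (λ w → q (U ∷ w)) + (down-paths (suc L) h (λ w → q (D ∷ w)) + paths L h (λ w → q (F ∷ w)))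
  first-step L h q =
    trans (count-++ P (map (U ∷_) W₁) _)
      (cong₂ _+_ up (trans (count-++ P (map (D ∷_) W₁) _) (cong₂ _+_ (down h) flat)))
    where
    P : List Step → Bool
    P w = valid h w ∧ q w
    W₁ = words (suc L)
    W₀ = words L
    up : count P (map (U ∷_) W₁) ≡ paths (suc L) (suc h) (λ w → q (U ∷ w))
    up = trans (count-map P (U ∷_) W₁) (count-cong W₁ (λ w → cong (_∧ q (U ∷ w)) (valid-U h w)))
    down : ∀ h → count (λ w → valid h w ∧ q w) (map (D ∷_) W₁) ≡ down-paths (suc L) h (λ w → q (D ∷ w))
    down zero    = trans (count-map _ (D ∷_) W₁) (count-none W₁)
    down (suc h) = count-map _ (D ∷_) W₁
    flat : count P (map (F ∷_) W₀) ≡ paths L h (λ w → q (F ∷ w))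
    flat = trans (count-map P (F ∷_) W₀) (count-cong W₀ (λ w → cong (_∧ q (F ∷ w)) (valid-F h w)))

  paths-none : ∀ L h → paths L h (λ _ → false) ≡ 0
  paths-none L h = trans (count-cong (words L) (λ w → ∧-zeroʳ (valid h w))) (count-none (words L))

  paths-short : ∀ L h q → L < h → paths L h q ≡ 0
  paths-short L             zero          q ()
  paths-short zero          (suc h)       q _ = refl
  paths-short (suc zero)    (suc zero)    q (s<s ())
  paths-short (suc zero)    (suc (suc h)) q _ = refl
  paths-short (suc (suc L)) (suc h)       q (s<s L+1<h) = trans (first-step L (suc h) q)
    (cong₂ _+_ (paths-short (suc L) (suc (suc h)) _ (m<n⇒m<1+n (m<n⇒m<1+n L+1<h)))
      (cong₂ _+_ (paths-short (suc L) h _ L+1<h)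
                 (paths-short L (suc h) _ (m<n⇒m<1+n (<-trans (n<1+n L) L+1<h)))))

  two-more : ∀ h t → h + (suc t + suc t) ≡ suc (suc (h + (t + t)))
  two-more = solve-∀

  total : ℕ → ℕ → ℕ
  total L h = paths L h (λ _ → true)

  -- the only path of length h from height h is D^h
  total-diag : ∀ h → total h h ≡ 1
  total-diag zero          = refl
  total-diag (suc zero)    = refl
  total-diag (suc (suc h)) = trans (first-step h (suc (suc h)) _)
    (cong₂ _+_ (paths-short (suc h) (suc (suc (suc h))) _ (m<n⇒m<1+n (n<1+n (suc h))))
      (cong₂ _+_ (total-diag (suc h)) (paths-short h (suc (suc h)) _ (m<n⇒m<1+n (n<1+n h)))))

  -- one step of the induction below: the first-step recurrence of paths
  -- matches S^(h+1) = S^h + x S^(h+1) + x S^(h+2)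
  total-step : ∀ t h → down-paths (suc (h + (t + t))) h (λ _ → true) ≡ pow S h (suc t) →
    total (suc h + (t + t)) (suc h) ≡ pow S (suc (suc h)) t → total (h + (t + t)) h ≡ pow S (suc h) t →
    total (h + (suc t + suc t)) h ≡ pow S (suc h) (suc t)
  total-step t h down up flat = begin
    total (h + (suc t + suc t)) h          ≡⟨ cong (λ L → total L h) (two-more h t) ⟩
    total (suc (suc (h + (t + t)))) h      ≡⟨ first-step (h + (t + t)) h _ ⟩
    total (suc h + (t + t)) (suc h) + (down-paths (suc (h + (t + t))) h _ + total (h + (t + t)) h)
      ≡⟨ cong₂ _+_ up (cong₂ _+_ down flat) ⟩
    pow S (suc (suc h)) t + (pow S h (suc t) + pow S (suc h) t)
      ≡⟨ +-comm (pow S (suc (suc h)) t) _ ⟩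
    pow S h (suc t) + pow S (suc h) t + pow S (suc (suc h)) t
      ≡⟨ cong₂ (λ a b → pow S h (suc t) + a + b) (sym (X⊛-shift (pow S (suc h)) (suc t))) (sym (X⊛-shift (pow S (suc (suc h))) (suc t))) ⟩
    (pow S h ⊕ X ⊛ pow S (suc h) ⊕ X ⊛ pow S (suc (suc h))) (suc t)
      ≡⟨ sym (pow-S-rec h (suc t)) ⟩
    pow S (suc h) (suc t)                  ∎
    where open ≡-Reasoning

  total-even : ∀ t h → total (h + (t + t)) h ≡ pow S (suc h) t
  total-even zero    h       = trans (cong (λ L → total L h) (+-identityʳ h)) (trans (total-diag h) (sym (pow-S-zero (suc h))))
  total-even (suc t) zero    = total-step t zero refl (total-even t 1) (total-even t 0)
  total-even (suc t) (suc h) = total-step t (suc h)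
    (trans (cong (λ L → total L h) (sym (two-more h t))) (total-even (suc t) h))
    (total-even t (suc (suc h))) (total-even t (suc h))

  down-total : ∀ t h → down-paths (suc (h + (t + t))) h (λ _ → true) ≡ pow S h (suc t)
  down-total t zero    = refl
  down-total t (suc h) = trans (cong (λ L → total L h) (sym (two-more h t))) (total-even (suc t) h)

  runs : ℕ → ℕ → ℕ → ℕ
  runs L h j = paths L h (λ w → initialUps w ≡ᵇ j)

  runs-up : ∀ L h j → runs (suc L) h (suc j) ≡ runs L (suc h) j
  runs-up zero    zero          j = refl
  runs-up zero    (suc zero)    j = refl
  runs-up zero    (suc (suc h)) j = refl
  runs-up (suc L) h             j = trans (first-step L h _)
      (trans (cong (runs (suc L) (suc h) j +_) (cong₂ _+_ (no-down h) (paths-none L h))) (+-identityʳ _))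
    where
    no-down : ∀ h → down-paths (suc L) h (λ _ → false) ≡ 0
    no-down zero    = refl
    no-down (suc h) = paths-none (suc L) h

  runs-shift : ∀ j a h → runs (a + j) h j ≡ runs a (j + h) 0
  runs-shift zero    a h = cong (λ L → runs L h 0) (+-identityʳ a)
  runs-shift (suc j) a h = begin
    runs (a + suc j) h (suc j)   ≡⟨ cong (λ L → runs L h (suc j)) (+-suc a j) ⟩
    runs (suc (a + j)) h (suc j) ≡⟨ runs-up (a + j) h j ⟩
    runs (a + j) (suc h) j       ≡⟨ runs-shift j a (suc h) ⟩
    runs a (j + suc h) 0         ≡⟨ cong (λ h' → runs a h' 0) (+-suc j h) ⟩
    runs a (suc j + h) 0         ∎
    where open ≡-Reasoning

  -- after j initial up steps a path still needs j + h steps to come down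
  runs-short : ∀ L h j → L < j + (j + h) → runs L h j ≡ 0
  runs-short L       h zero    L<h = paths-short L h _ L<h
  runs-short zero    h (suc j) _   = cong (λ b → ind b + 0) (∧-zeroʳ (valid h []))
  runs-short (suc L) h (suc j) (s<s L<) =
    trans (runs-up L h j) (runs-short L (suc h) j (subst (L <_) (cong (j +_) (sym (+-suc j h))) L<))

  runs-flat : ∀ L h → runs (suc (suc L)) h 0 ≡ down-paths (suc L) h (λ _ → true) + total L h
  runs-flat L h = trans (first-step L h _) (cong (_+ (down-paths (suc L) h _ + total L h)) (paths-none (suc L) (suc h)))

  runs-value : ∀ j t → runs (j + (t + t)) j 0 ≡ pow S j t + (X ⊛ pow S (suc j)) t
  runs-value zero          zero    = refl
  runs-value (suc zero)    zero    = refl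
  runs-value (suc (suc j)) zero    = trans (runs-flat (j + 0) (suc (suc j)))
    (cong₂ _+_ (total-even 0 (suc j)) (paths-short (j + 0) (suc (suc j)) _ (s≤s (≤-trans (≤-reflexive (+-identityʳ j)) (n≤1+n j)))))
  runs-value j             (suc t) = begin
    runs (j + (suc t + suc t)) j 0           ≡⟨ cong (λ L → runs L j 0) (two-more j t) ⟩
    runs (suc (suc (j + (t + t)))) j 0       ≡⟨ runs-flat (j + (t + t)) j ⟩
    down-paths (suc (j + (t + t))) j _ + total (j + (t + t)) j
      ≡⟨ cong₂ _+_ (down-total t j) (trans (total-even t j) (sym (X⊛-shift (pow S (suc j)) (suc t)))) ⟩
    pow S j (suc t) + (X ⊛ pow S (suc j)) (suc t) ∎
    where open ≡-Reasoning

  schroder-runs : ∀ m j → runs (m + m) 0 j ≡ Ψ 0 j m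
  schroder-runs m j with j ≤? m
  ... | yes j≤m = begin
    runs (m + m) 0 j                          ≡⟨ cong (λ L → runs L 0 j) length-split ⟩
    runs (j + (t + t) + j) 0 j                ≡⟨ runs-shift j (j + (t + t)) 0 ⟩
    runs (j + (t + t)) (j + 0) 0              ≡⟨ cong (λ h → runs (j + (t + t)) h 0) (+-identityʳ j) ⟩
    runs (j + (t + t)) j 0                    ≡⟨ runs-value j t ⟩
    pow S j t + (X ⊛ pow S (suc j)) t         ≡⟨ sym (pow-S-V0 j t) ⟩
    (pow S j ⊛ V 0) t                         ≡⟨ sym (X-pow-coeff j (pow S j ⊛ V 0) t) ⟩
    Ψ 0 j (j + t)                             ≡⟨ cong (Ψ 0 j) j+t≡m ⟩
    Ψ 0 j m                                   ∎
    where
    open ≡-Reasoning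
    t = m ∸ j
    j+t≡m : j + t ≡ m
    j+t≡m = m+[n∸m]≡n j≤m
    rearrange : ∀ j t → (j + t) + (j + t) ≡ j + (t + t) + j
    rearrange = solve-∀
    length-split : m + m ≡ j + (t + t) + j
    length-split = trans (cong₂ _+_ (sym j+t≡m) (sym j+t≡m)) (rearrange j t)
  ... | no j≰m = trans (runs-short (m + m) 0 j too-short) (sym (X-pow-low j (pow S j ⊛ V 0) m m<j))
    where
    m<j : m < j
    m<j = ≰⇒> j≰m
    too-short : m + m < j + (j + 0)
    too-short = subst (m + m <_) (cong (j +_) (sym (+-identityʳ j))) (+-mono-< m<j m<j)

module Avoidance where

  open Booleans
  open Counting

  length-snoc : ∀ (e : List ℕ) x → length (e ++ [ x ]) ≡ suc (length e)
  length-snoc e x = trans (length-++ e) (+-comm (length e) 1)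

  at-snoc-< : ∀ (e : List ℕ) x p → p < length e → at (e ++ [ x ]) p ≡ at e p
  at-snoc-< (a ∷ e) x zero    _         = refl
  at-snoc-< (a ∷ e) x (suc p) (s<s p<n) = at-snoc-< e x p p<n

  at-snoc-= : ∀ (e : List ℕ) x → at (e ++ [ x ]) (length e) ≡ x
  at-snoc-= []      x = refl
  at-snoc-= (a ∷ e) x = at-snoc-= e x

  threshold : List ℕ → ℕ
  threshold []      = 1
  threshold (a ∷ e) = a ⊔ threshold e

  threshold-snoc : ∀ e x → threshold (e ++ [ x ]) ≡ threshold e ⊔ x
  threshold-snoc []      x = ⊔-comm x 1
  threshold-snoc (a ∷ e) x = trans (cong (a ⊔_) (threshold-snoc e x)) (sym (⊔-assoc a (threshold e) x))

  at≤threshold : ∀ e p → p < length e → at e p ≤ threshold e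
  at≤threshold (a ∷ e) zero    _         = m≤m⊔n a (threshold e)
  at≤threshold (a ∷ e) (suc p) (s<s p<n) = ≤-trans (at≤threshold e p p<n) (m≤n⊔m a (threshold e))

  below-threshold : ∀ e x → 1 ≤ x → x < threshold e → ∃ λ p → p < length e × x < at e p
  below-threshold []      x 1≤x x<1 = ⊥-elim (<⇒≱ x<1 1≤x)
  below-threshold (a ∷ e) x 1≤x x<th with ≤-total a (threshold e)
  ... | inj₁ a≤th =
    let (p , p<n , x<eₚ) = below-threshold e x 1≤x (subst (x <_) (m≤n⇒m⊔n≡n a≤th) x<th)
    in suc p , s<s p<n , x<eₚ
  ... | inj₂ th≤a = zero , z<s , subst (x <_) (m≥n⇒m⊔n≡m th≤a) x<th

  -- after a prefix with threshold M, the new entry x is allowed iff x = 0 or x ≥ M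
  allowed : ℕ → ℕ → Bool
  allowed M x = (x ≡ᵇ 0) ∨ (M ≤ᵇ x)

  not-allowed : ∀ M x → 0 < x → x < M → T (not (allowed M x))
  not-allowed M (suc x) _ x<M = subst (T ∘ not) (sym (false-unless (λ t → <⇒≱ x<M (≤ᵇ⇒≤ M (suc x) t)))) tt

  not-allowed⁻ : ∀ M x → T (not (allowed M x)) → 0 < x × x < M
  not-allowed⁻ M zero    ()
  not-allowed⁻ M (suc x) t = z<s , ≰⇒> (λ M≤x → subst (T ∘ not) (true-if (≤⇒≤ᵇ M≤x)) t)

  record Occurrence021 (f : List ℕ) : Set where
    constructor occurrence
    field
      i j k : ℕ
      i<j   : i < j
      j<k   : j < k
      k<n   : k < length f
      low   : at f i < at f k
      high  : at f k < at f j

  any-upTo⁻ : ∀ n (p : ℕ → Bool) → T (any p (upTo n)) → ∃ λ i → i < n × T (p i)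
  any-upTo⁻ n p t with find (any⁻ p (upTo n) t)
  ... | i , i∈ , pᵢ = i , ∈-upTo⁻ i∈ , pᵢ

  any-upTo⁺ : ∀ n (p : ℕ → Bool) {i} → i < n → T (p i) → T (any p (upTo n))
  any-upTo⁺ n p i<n pᵢ = any⁺ p (lose (∈-upTo⁺ i<n) pᵢ)

  is021 : List ℕ → ℕ → ℕ → ℕ → Bool
  is021 f i j k = (i <ᵇ j) ∧ (j <ᵇ k) ∧ (at f i <ᵇ at f k) ∧ (at f k <ᵇ at f j)

  contains⇒occurrence : ∀ f → T (contains021 f) → Occurrence021 f
  contains⇒occurrence f t =
    let (k , k<n , tₖ) = any-upTo⁻ n (λ k → any (λ j → any (λ i → is021 f i j k) N) N) t
        (j , _   , tⱼ) = any-upTo⁻ n (λ j → any (λ i → is021 f i j k) N) tₖ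
        (i , _   , tᵢ) = any-upTo⁻ n (λ i → is021 f i j k) tⱼ
        (i<j , r₁)     = to T-∧ tᵢ
        (j<k , r₂)     = to T-∧ r₁
        (low , high)   = to T-∧ r₂
    in occurrence i j k (<ᵇ⇒< _ _ i<j) (<ᵇ⇒< _ _ j<k) k<n (<ᵇ⇒< _ _ low) (<ᵇ⇒< _ _ high)
    where
    n = length f
    N = upTo n

  occurrence⇒contains : ∀ f → Occurrence021 f → T (contains021 f)
  occurrence⇒contains f (occurrence i j k i<j j<k k<n low high) =
    any-upTo⁺ n (λ k → any (λ j → any (λ i → is021 f i j k) N) N) k<n
      (any-upTo⁺ n (λ j → any (λ i → is021 f i j k) N) j<n
        (any-upTo⁺ n (λ i → is021 f i j k) (<-trans i<j j<n)
          (from T-∧ (<⇒<ᵇ i<j , from T-∧ (<⇒<ᵇ j<k , from T-∧ (<⇒<ᵇ low , <⇒<ᵇ high))))))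
    where
    n = length f
    N = upTo n
    j<n = <-trans j<k k<n

  occurrence-restrict : ∀ e x → Occurrence021 (e ++ [ x ]) → Occurrence021 e ⊎ T (not (allowed (threshold e) x))
  occurrence-restrict e x (occurrence i j k i<j j<k k<n low high)
    with m≤n⇒m<n∨m≡n (≤-pred (subst (k <_) (length-snoc e x) k<n))
  ... | inj₁ k<len = inj₁ (occurrence i j k i<j j<k k<len
          (subst₂ _<_ (at-snoc-< e x i i<len) (at-snoc-< e x k k<len) low)
          (subst₂ _<_ (at-snoc-< e x k k<len) (at-snoc-< e x j j<len) high))
    where
    j<len = <-trans j<k k<len
    i<len = <-trans i<j j<len
  ... | inj₂ refl = inj₂ (not-allowed (threshold e) x 0<x x<th)
    where
    0<x : 0 < x
    0<x = subst (0 <_) (at-snoc-= e x) (≤-<-trans z≤n low)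
    x<th : x < threshold e
    x<th = <-≤-trans (subst₂ _<_ (at-snoc-= e x) (at-snoc-< e x j j<k) high) (at≤threshold e j j<k)

  occurrence-extend : ∀ e x → Occurrence021 e → Occurrence021 (e ++ [ x ])
  occurrence-extend e x (occurrence i j k i<j j<k k<n low high) =
    occurrence i j k i<j j<k (subst (k <_) (sym (length-snoc e x)) (m<n⇒m<1+n k<n))
      (subst₂ _<_ (sym (at-snoc-< e x i i<n)) (sym (at-snoc-< e x k k<n)) low)
      (subst₂ _<_ (sym (at-snoc-< e x k k<n)) (sym (at-snoc-< e x j j<n)) high)
    where
    j<n = <-trans j<k k<n
    i<n = <-trans i<j j<n

  -- a forbidden x after 0 ∷ t completes 0, (an entry above x), x to a 021
  occurrence-new : ∀ t x → T (not (allowed (threshold (0 ∷ t)) x)) → Occurrence021 ((0 ∷ t) ++ [ x ])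
  occurrence-new t x forbidden with not-allowed⁻ _ x forbidden
  ... | 0<x , x<th with below-threshold (0 ∷ t) x 0<x x<th
  ...   | zero  , _   , x<0   = ⊥-elim (<⇒≱ x<0 z≤n)
  ...   | suc j , j<n , x<eⱼ  = occurrence 0 (suc j) (length (0 ∷ t)) z<s j<n
          (subst (suc (length t) <_) (sym (length-snoc (0 ∷ t) x)) (n<1+n _))
          (subst (0 <_) (sym (at-snoc-= (0 ∷ t) x)) 0<x)
          (subst₂ _<_ (sym (at-snoc-= (0 ∷ t) x)) (sym (at-snoc-< (0 ∷ t) x (suc j) j<n)) x<eⱼ)

  contains-snoc : ∀ t x →
    contains021 ((0 ∷ t) ++ [ x ]) ≡ contains021 (0 ∷ t) ∨ not (allowed (threshold (0 ∷ t)) x)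
  contains-snoc t x = bool-ext forward backward
    where
    e = 0 ∷ t
    forward : T (contains021 (e ++ [ x ])) → T (contains021 e ∨ not (allowed (threshold e) x))
    forward c with occurrence-restrict e x (contains⇒occurrence _ c)
    ... | inj₁ occ       = from T-∨ (inj₁ (occurrence⇒contains e occ))
    ... | inj₂ forbidden = from T-∨ (inj₂ forbidden)
    backward : T (contains021 e ∨ not (allowed (threshold e) x)) → T (contains021 (e ++ [ x ]))
    backward c with to T-∨ c
    ... | inj₁ cₑ        = occurrence⇒contains _ (occurrence-extend e x (contains⇒occurrence e cₑ))
    ... | inj₂ forbidden = occurrence⇒contains _ (occurrence-new t x forbidden)

  avoids-snoc : ∀ t x →
    avoids021 ((0 ∷ t) ++ [ x ]) ≡ avoids021 (0 ∷ t) ∧ allowed (threshold (0 ∷ t)) x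
  avoids-snoc t x = trans (cong not (contains-snoc t x)) (not-∨-not (contains021 (0 ∷ t)) _)

  maxCount-Σ : ∀ e → maxCount e ≡ Σ< (length e) (λ p → ind (at e p ≡ᵇ p))
  maxCount-Σ e = trans (length-filter _ (upTo (length e))) (sum-upTo _ (length e))

  maxCount-snoc : ∀ e x → maxCount (e ++ [ x ]) ≡ maxCount e + ind (x ≡ᵇ length e)
  maxCount-snoc e x = begin
    maxCount f                                              ≡⟨ maxCount-Σ f ⟩
    Σ< (length f) (λ p → ind (at f p ≡ᵇ p))                 ≡⟨ cong (λ m → Σ< m (λ p → ind (at f p ≡ᵇ p))) (length-snoc e x) ⟩
    Σ< (suc n) (λ p → ind (at f p ≡ᵇ p))                    ≡⟨ Σ<-last n _ ⟩
    Σ< n (λ p → ind (at f p ≡ᵇ p)) + ind (at f n ≡ᵇ n)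
      ≡⟨ cong₂ _+_ (Σ<-cong n (λ p p<n → cong (λ a → ind (a ≡ᵇ p)) (at-snoc-< e x p p<n)))
                   (cong (λ a → ind (a ≡ᵇ n)) (at-snoc-= e x)) ⟩
    Σ< n (λ p → ind (at e p ≡ᵇ p)) + ind (x ≡ᵇ n)           ≡⟨ cong (_+ ind (x ≡ᵇ n)) (sym (maxCount-Σ e)) ⟩
    maxCount e + ind (x ≡ᵇ n)                               ∎
    where
    open ≡-Reasoning
    f = e ++ [ x ]
    n = length e

module Completions where

  open Booleans
  open Counting
  open Avoidance

  -- completions r n M c K: ways to append r entries to a 021-avoiding prefix
  -- (starting with 0) of length n, threshold M and c maximal entries, so that
  -- the result is 021-avoiding with exactly K maximal entries
  completions : ℕ → ℕ → ℕ → ℕ → ℕ → ℕ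
  completions zero    n M c K = ind (c ≡ᵇ K)
  completions (suc r) n M c K = Σ< (suc n) λ x →
    if allowed M x then completions r (suc n) (M ⊔ x) (c + ind (x ≡ᵇ n)) K else 0

  -- the sequences e ++ [x] with x ≤ n; I (n + 1) is obtained from I n this way
  children : ℕ → List ℕ → List (List ℕ)
  children n e = map (λ x → e ++ [ x ]) (upTo (suc n))

  extensions : ℕ → ℕ → List ℕ → List (List ℕ)
  extensions n zero    e = [ e ]
  extensions n (suc r) e = concatMap (extensions (suc n) r) (children n e)

  concatMap-concatMap : ∀ {A B C : Set} (g : B → List C) (f : A → List B) xs →
    concatMap g (concatMap f xs) ≡ concatMap (concatMap g ∘ f) xs
  concatMap-concatMap g f []       = refl
  concatMap-concatMap g f (x ∷ xs) =
    trans (concatMap-++ g (f x) (concatMap f xs)) (cong (concatMap g (f x) ++_) (concatMap-concatMap g f xs))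

  I-extensions : ∀ r n → I (r + n) ≡ concatMap (extensions n r) (I n)
  I-extensions zero    n = sym (concatMap-pure (I n))
  I-extensions (suc r) n = begin
    I (suc (r + n))                                        ≡⟨ cong I (sym (+-suc r n)) ⟩
    I (r + suc n)                                          ≡⟨ I-extensions r (suc n) ⟩
    concatMap (extensions (suc n) r) (concatMap (children n) (I n))
      ≡⟨ concatMap-concatMap (extensions (suc n) r) (children n) (I n) ⟩
    concatMap (extensions n (suc r)) (I n)                 ∎
    where open ≡-Reasoning

  good : ℕ → List ℕ → Bool
  good K e = avoids021 e ∧ (maxCount e ≡ᵇ K)

  extension-count : ∀ r n t K → length (0 ∷ t) ≡ n →
    count (good K) (extensions n r (0 ∷ t))
      ≡ (if avoids021 (0 ∷ t) then completions r n (threshold (0 ∷ t)) (maxCount (0 ∷ t)) K else 0)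
  extension-count zero n t K _ with avoids021 (0 ∷ t)
  ... | true  = +-identityʳ _
  ... | false = refl
  extension-count (suc r) .(suc (length t)) t K refl = begin
    count (good K) (concatMap (extensions (suc n) r) (children n e))
      ≡⟨ count-concatMap (good K) (extensions (suc n) r) (children n e) ⟩
    sum (map (count (good K) ∘ extensions (suc n) r) (map (λ x → e ++ [ x ]) (upTo (suc n))))
      ≡⟨ cong sum (sym (map-∘ {g = count (good K) ∘ extensions (suc n) r} {f = λ x → e ++ [ x ]} (upTo (suc n)))) ⟩
    sum (map (λ x → count (good K) (extensions (suc n) r (e ++ [ x ]))) (upTo (suc n)))
      ≡⟨ sum-upTo (λ x → count (good K) (extensions (suc n) r (e ++ [ x ]))) (suc n) ⟩
    Σ< (suc n) (λ x → count (good K) (extensions (suc n) r (e ++ [ x ])))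
      ≡⟨ Σ<-cong (suc n) (λ x _ → child x) ⟩
    Σ< (suc n) (λ x → if avoids021 e ∧ allowed M x then completions r (suc n) (M ⊔ x) (c + ind (x ≡ᵇ n)) K else 0)
      ≡⟨ gather (avoids021 e) ⟩
    (if avoids021 e then completions (suc r) n M c K else 0) ∎
    where
    open ≡-Reasoning
    e = 0 ∷ t
    n = suc (length t)
    M = threshold e
    c = maxCount e
    child : ∀ x → count (good K) (extensions (suc n) r (e ++ [ x ]))
      ≡ (if avoids021 e ∧ allowed M x then completions r (suc n) (M ⊔ x) (c + ind (x ≡ᵇ n)) K else 0)
    child x = trans (extension-count r (suc n) (t ++ [ x ]) K (cong suc (length-snoc t x)))
      (if-cong (avoids-snoc t x)
        (cong₂ (λ M' c' → completions r (suc n) M' c' K) (threshold-snoc e x) (maxCount-snoc e x)))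
    gather : ∀ b → Σ< (suc n) (λ x → if b ∧ allowed M x then completions r (suc n) (M ⊔ x) (c + ind (x ≡ᵇ n)) K else 0)
      ≡ (if b then completions (suc r) n M c K else 0)
    gather true  = refl
    gather false = Σ<-zero (suc n) (λ _ _ → refl)

  -- every inversion sequence of positive length extends the prefix (0)
  inversion-count : ∀ r K → count (good K) (I (suc r)) ≡ completions r 1 1 1 K
  inversion-count r K = begin
    count (good K) (I (suc r))                            ≡⟨ cong (count (good K) ∘ I) (+-comm 1 r) ⟩
    count (good K) (I (r + 1))                            ≡⟨ cong (count (good K)) (I-extensions r 1) ⟩
    count (good K) (extensions 1 r (0 ∷ []) ++ [])        ≡⟨ count-++ (good K) (extensions 1 r (0 ∷ [])) [] ⟩
    count (good K) (extensions 1 r (0 ∷ [])) + 0          ≡⟨ +-identityʳ _ ⟩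
    count (good K) (extensions 1 r (0 ∷ []))              ≡⟨ extension-count r 1 [] K refl ⟩
    completions r 1 1 1 K                                 ∎
    where open ≡-Reasoning

module CompletionSeries where

  open Booleans
  open Counting
  open Avoidance
  open Completions
  open PowerSeries
  open SchroderSeries

  -- more maximal entries than targeted cannot be undone
  completions-low : ∀ r n M c K → K < c → completions r n M c K ≡ 0
  completions-low zero    n M c K K<c = cong ind (≡ᵇ-≢ (λ c≡K → <⇒≢ K<c (sym c≡K)))
  completions-low (suc r) n M c K K<c = Σ<-zero (suc n) term-zero
    where
    term-zero : ∀ x → x < suc n →
      (if allowed M x then completions r (suc n) (M ⊔ x) (c + ind (x ≡ᵇ n)) K else 0) ≡ 0
    term-zero x _ with allowed M x
    ... | true  = completions-low r (suc n) (M ⊔ x) _ K (<-≤-trans K<c (m≤m+n c _))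
    ... | false = refl

  Σ<-allowed : ∀ M g (f : ℕ → ℕ) → 1 ≤ M →
    Σ< (suc (M + g)) (λ x → if allowed M x then f x else 0) ≡ f 0 + Σ< (suc g) (λ i → f (M + i))
  Σ<-allowed (suc M) g f _ = cong (f 0 +_) (begin
    Σ< (suc (M + g)) (h ∘ suc)                               ≡⟨ cong (λ m → Σ< m (h ∘ suc)) (sym (+-suc M g)) ⟩
    Σ< (M + suc g) (h ∘ suc)                                 ≡⟨ Σ<-+ M (suc g) (h ∘ suc) ⟩
    Σ< M (h ∘ suc) + Σ< (suc g) (λ i → h (suc (M + i)))      ≡⟨ cong₂ _+_ (Σ<-zero M {h ∘ suc} below) (Σ<-cong (suc g) {λ i → h (suc (M + i))} above) ⟩
    Σ< (suc g) (λ i → f (suc M + i))                         ∎)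
    where
    open ≡-Reasoning
    h : ℕ → ℕ
    h x = if allowed (suc M) x then f x else 0
    below : ∀ i → i < M → h (suc i) ≡ 0
    below i i<M = cong (λ b → if b then f (suc i) else 0)
      (false-unless (λ t → <⇒≱ i<M (≤-pred (<ᵇ⇒< M (suc i) t))))
    above : ∀ i → i < suc g → h (suc (M + i)) ≡ f (suc (M + i))
    above i _ = cong (λ b → if b then f (suc (M + i)) else 0) (true-if (<⇒<ᵇ (s≤s (m≤m+n M i))))

  no-more-maximal : ∀ k c → ind (c ≡ᵇ k + c) ≡ C k 0
  no-more-maximal zero    c = cong ind (≡ᵇ-refl c)
  no-more-maximal (suc k) c = cong ind (≡ᵇ-≢ (m≢1+n+m c))

  completions-closed : ∀ r g k M c → 1 ≤ M → completions r (M + g) M c (k + c) ≡ Ψ g k r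
  completions-closed zero    g k M       c _ = trans (no-more-maximal k c) (sym (Ψ-zero g k))
  completions-closed (suc r) g k (suc M) c _ = begin
    Σ< (suc (N + g)) (λ x → if allowed N x then next x else 0)
      ≡⟨ Σ<-allowed N g next (s≤s z≤n) ⟩
    next 0 + Σ< (suc g) (λ i → next (N + i))
      ≡⟨ cong (next 0 +_) (Σ<-last g (λ i → next (N + i))) ⟩
    next 0 + (Σ< g (λ i → next (N + i)) + next (N + g))
      ≡⟨ cong₂ _+_ restart (cong₂ _+_ intermediate new-maximum) ⟩
    Ψ (suc g) k r + (ΣΨ g k r + E k r)
      ≡⟨ sym (+-assoc (Ψ (suc g) k r) _ _) ⟩
    Ψ (suc g) k r + ΣΨ g k r + E k r
      ≡⟨ sym (Ψ-suc g k r) ⟩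
    Ψ g k (suc r) ∎
    where
    open ≡-Reasoning
    N = suc M
    K = k + c
    next : ℕ → ℕ
    next x = completions r (suc (N + g)) (N ⊔ x) (c + ind (x ≡ᵇ N + g)) K

    -- appending 0: the gap grows by one
    restart : next 0 ≡ Ψ (suc g) k r
    restart = trans (cong₂ (λ n c' → completions r n N c' K) (sym (+-suc N g)) (+-identityʳ c))
      (completions-closed r (suc g) k N c (s≤s z≤n))

    -- appending an entry N + i, i < g: the gap becomes g + 1 − i
    gaps : ∀ g M → 1 ≤ M → Σ< g (λ i → completions r (suc (M + g)) (M + i) c K) ≡ ΣΨ g k r
    gaps zero    M _   = refl
    gaps (suc g) M 1≤M = cong₂ _+_ first (trans (Σ<-cong g shifted) (gaps g (suc M) (s≤s z≤n)))
      where
      lengths : ∀ M g → suc (M + suc g) ≡ M + 0 + suc (suc g)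
      lengths = solve-∀
      first : completions r (suc (M + suc g)) (M + 0) c K ≡ Ψ (suc (suc g)) k r
      first = trans (cong (λ n → completions r n (M + 0) c K) (lengths M g))
        (completions-closed r (suc (suc g)) k (M + 0) c (≤-trans 1≤M (m≤m+n M 0)))
      shifted : ∀ i → i < g →
        completions r (suc (M + suc g)) (M + suc i) c K ≡ completions r (suc (suc M + g)) (suc M + i) c K
      shifted i _ = cong₂ (λ n M' → completions r n M' c K) (cong suc (+-suc M g)) (+-suc M i)

    intermediate : Σ< g (λ i → next (N + i)) ≡ ΣΨ g k r
    intermediate = trans (Σ<-cong g simplify) (gaps g N (s≤s z≤n))
      where
      simplify : ∀ i → i < g → next (N + i) ≡ completions r (suc (N + g)) (N + i) c K
      simplify i i<g = cong₂ (λ M' c' → completions r (suc (N + g)) M' c' K) (m≤n⇒m⊔n≡n (m≤m+n N i))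
        (trans (cong (λ b → c + ind b) (≡ᵇ-≢ (λ eq → <⇒≢ i<g (+-cancelˡ-≡ N i g eq)))) (+-identityʳ c))

    -- appending the largest possible entry N + g: one more maximal entry, gap 1
    new-maximum : next (N + g) ≡ E k r
    new-maximum = trans (cong₂ (λ M' b → completions r (suc (N + g)) M' (c + ind b) K)
        (m≤n⇒m⊔n≡n (m≤m+n N g)) (≡ᵇ-refl (N + g))) (maximal k)
      where
      maximal : ∀ k → completions r (suc (N + g)) (N + g) (c + 1) (k + c) ≡ E k r
      maximal zero     = completions-low r _ _ (c + 1) c (m<m+n c z<s)
      maximal (suc k') = trans (cong₂ (λ n K' → completions r n (N + g) (c + 1) K') (+-comm 1 (N + g))
                           (trans (sym (+-suc k' c)) (cong (k' +_) (+-comm 1 c))))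
        (completions-closed r 1 k' (N + g) (c + 1) (s≤s z≤n))

open Counting using (count; length-filter²)
open Completions using (good; completions; inversion-count)
open CompletionSeries using (completions-closed)
open SchroderSeries using (Ψ)
open SchroderPaths using (runs; schroder-runs)

theorem3 : (n k : ℕ) → 1 ≤ n → 1 ≤ k →
    length (filter (λ e → maxCount e ≟ k) (I021 n))
    ≡ length (filter (λ w → initialUps w ≟ k ∸ 1) (schroder (n ∸ 1)))
theorem3 (suc r) (suc j) _ _ = begin
  length (filter (λ e → maxCount e ≟ suc j) (I021 (suc r)))
    ≡⟨ length-filter² (λ e → T? (avoids021 e)) (λ e → maxCount e ≟ suc j) (I (suc r)) ⟩
  count (good (suc j)) (I (suc r))       ≡⟨ inversion-count r (suc j) ⟩
  completions r 1 1 1 (suc j)            ≡⟨ cong (completions r 1 1 1) (+-comm 1 j) ⟩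
  completions r (1 + 0) 1 1 (j + 1)      ≡⟨ completions-closed r 0 j 1 1 ≤-refl ⟩
  Ψ 0 j r                                ≡⟨ schroder-runs r j ⟨
  runs (r + r) 0 j
    ≡⟨ length-filter² (λ w → T? (valid 0 w)) (λ w → initialUps w ≟ j) (words (r + r)) ⟨
  length (filter (λ w → initialUps w ≟ j) (schroder r)) ∎
  where open ≡-Reasoning
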